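{- Let $G$ be a finite group and $S\subseteq G\setminus\{1\}$. If $\mathrm{Cay}(G,S)$ has Cayley index $i$ and $\mathrm{Aut}(\mathrm{Cay}(G,S))$ has at least two regular subgroups, then $G$ has a proper subgroup of index at most $i$.
   Context: $\mathrm{Cay}(G,S)$ is the digraph with vertex set $G$ and arcs $(u,v)$ whenever $vu^{ -1}\in S$. $\mathrm{Aut}$ denotes the group of arc-preserving permutations of the vertices. $G$ is identified with its right regular representation in $\mathrm{Aut}(\mathrm{Cay}(G,S))$, and the Cayley index is $|\mathrm{Aut}(\mathrm{Cay}(G,S)):G|$. A subgroup is regular if it acts regularly on the vertex set. -}

module Defs where

open import Data.Nat using (ℕ; _*_; _≤_)
open import Data.Fin using (Fin)
open import Data.Fin.Subset using (Subset; _∈_; _∉_; ∣_∣)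
open import Data.List using (List; length)
open import Data.List.Relation.Unary.All using (All)
open import Data.List.Relation.Unary.Any using (Any)
open import Data.List.Relation.Unary.AllPairs using (AllPairs)
open import Data.Product using (Σ; ∃; _×_)
open import Function using (_∘_; id)
open import Function.Definitions using (Bijective)
open import Relation.Binary.PropositionalEquality using (_≡_; _≗_)
open import Relation.Nullary using (¬_)
open import Level using (0ℓ; suc)

-- A finite group of order n, realised on the carrier Fin n
-- (every finite group is isomorphic to one of these).
record FinGroup (n : ℕ) : Set where
  field
    _·_     : Fin n → Fin n → Fin n
    e       : Fin n
    inv     : Fin n → Fin n
    assoc   : ∀ x y z → (x · y) · z ≡ x · (y · z)
    identˡ  : ∀ x → e · x ≡ x
    identʳ  : ∀ x → x · e ≡ x
    inverseˡ : ∀ x → inv x · x ≡ e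
    inverseʳ : ∀ x → x · inv x ≡ e

module _ {n : ℕ} (G : FinGroup n) where
  open FinGroup G

  Arc : Subset n → Fin n → Fin n → Set
  Arc S u v = (v · inv u) ∈ S

  IsAut : Subset n → (Fin n → Fin n) → Set
  IsAut S f = Bijective _≡_ _≡_ f
            × (∀ u v → (Arc S u v → Arc S (f u) (f v)) × (Arc S (f u) (f v) → Arc S u v))

  -- Aut(Cay(G,S)) has cardinality i * |G| (Cayley index i): L is a duplicate-free
  -- (up to pointwise equality) complete list of the automorphisms, of length i * n.
  HasCayleyIndex : Subset n → ℕ → Set
  HasCayleyIndex S i =
    Σ (List (Fin n → Fin n)) λ L →
      All (IsAut S) L
      × (∀ f → IsAut S f → Any (λ g → f ≗ g) L)
      × AllPairs (λ f g → ¬ (f ≗ g)) L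
      × (length L ≡ i * n)

  record IsRegularSubgroupOfAut (S : Subset n) (H : (Fin n → Fin n) → Set) : Set where
    field
      resp    : ∀ {f g} → H f → f ≗ g → H g
      ⊆Aut    : ∀ {f} → H f → IsAut S f
      has-id  : H id
      ∘-closed : ∀ {f g} → H f → H g → H (f ∘ g)
      inv-closed : ∀ {f} → H f → ∃ λ g → H g × (g ∘ f ≗ id) × (f ∘ g ≗ id)
      transitive : ∀ u v → ∃ λ f → H f × (f u ≡ v)
      semiregular : ∀ {f g} u → H f → H g → f u ≡ g u → f ≗ g

  TwoRegularSubgroups : Subset n → Set₁
  TwoRegularSubgroups S =
    Σ ((Fin n → Fin n) → Set) λ H₁ → Σ ((Fin n → Fin n) → Set) λ H₂ →
      IsRegularSubgroupOfAut S H₁ × IsRegularSubgroupOfAut S H₂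
      × ∃ λ f → H₁ f × ¬ H₂ f

  IsSubgroup : Subset n → Set
  IsSubgroup K = (e ∈ K) × (∀ {x y} → x ∈ K → y ∈ K → (x · y) ∈ K)
               × (∀ {x} → x ∈ K → inv x ∈ K)

  -- G has a proper subgroup of index at most i  (index |G|/|K| ≤ i  ⇔  |G| ≤ i·|K|)
  HasProperSubgroupOfIndexAtMost : ℕ → Set
  HasProperSubgroupOfIndexAtMost i =
    Σ (Subset n) λ K → IsSubgroup K × (∃ λ x → x ∉ K) × (n ≤ i * ∣ K ∣)

{-# OPTIONS --safe #-}
module Submission where

-- Let A be the automorphism group of Cay(G,S), containing the right regular
-- representation ρ(G). A regular subgroup H of A containing ρ(G) equals ρ(G), by
-- semiregularity, so of two distinct regular subgroups one, H, omits some ρ g.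
-- Then K = {g ∣ ρ g ∈ H} is a proper subgroup of G, and the product formula
-- |H| |G| = |H ρ(G)| |K| ≤ |A| |K| reads n·n ≤ i·n·|K|, i.e. |G : K| ≤ i.
-- The product formula is realised by an injection G × G → A × K, sending (a , b)
-- to h_a ∘ ρ b (h_a the element of H with h_a 1 = a) together with the offset of
-- b from a chosen representative of its coset of K.

open import Defs
open import Algebra.Bundles using (Group)
import Algebra.Properties.Group as GroupProperties
open import Data.Bool using (true)
open import Data.Bool.Properties using (T-≡)
open import Data.Empty using (⊥-elim)
open import Data.Fin using (Fin; zero; suc; _≟_)
open import Data.Fin.Properties
  using (all?; any?; ¬∀⟶∃¬; injective⇒≤; *↔×; suc-injective; nonZeroIndex)
open import Data.Fin.Subset using (Subset; _∈_; _∉_; ∣_∣; inside; outside)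
open import Data.List using (List; length; lookup)
open import Data.List.Relation.Unary.Any using (Any; index)
open import Data.List.Relation.Unary.Any.Properties using (lookup-index)
open import Data.Nat using (ℕ; _*_; _≤_; NonZero)
open import Data.Nat.Properties using (*-cancelˡ-≤; *-comm; *-assoc)
open import Data.Product using (Σ; ∃; _×_; _,_; proj₁; proj₂)
open import Data.Vec as Vec using (_∷_; tabulate; here; there)
open import Data.Vec.Properties using (lookup∘tabulate; []=⇒lookup; lookup⇒[]=)
open import Function using (_∘_; Equivalence; Injection; mk↣)
open import Function.Construct.Composition using (_↣-∘_; bijective)
open import Function.Definitions using (Injective)
open import Function.Properties.Inverse using (↔⇒↣; ↔-sym)
open import Level using (0ℓ)
open import Relation.Binary.PropositionalEquality
  using (_≡_; refl; sym; trans; cong; cong₂; subst; _≗_; isEquivalence; module ≡-Reasoning)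
open import Relation.Nullary using (¬_; yes; no; does; isYes)
open import Relation.Nullary.Decidable using (dec-true; isYes≗does; toWitness; map′)
open import Relation.Unary using (Pred; Decidable)

open ≡-Reasoning

×-injective⇒*-≤ : ∀ {a b c d} {f : Fin a × Fin b → Fin c × Fin d} →
                  Injective _≡_ _≡_ f → a * b ≤ c * d
×-injective⇒*-≤ f-inj =
  injective⇒≤ (Injection.injective (↔⇒↣ (↔-sym *↔×) ↣-∘ (mk↣ f-inj ↣-∘ ↔⇒↣ *↔×)))

rank : ∀ {m} {p : Subset m} {x} → x ∈ p → Fin ∣ p ∣
rank {p = inside  ∷ p} here        = zero
rank {p = inside  ∷ p} (there x∈p) = suc (rank x∈p)
rank {p = outside ∷ p} (there x∈p) = rank x∈p

rank-injective : ∀ {m} {p : Subset m} {x y} (x∈p : x ∈ p) (y∈p : y ∈ p) →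
                 rank x∈p ≡ rank y∈p → x ≡ y
rank-injective {p = inside  ∷ p} here        here        _  = refl
rank-injective {p = inside  ∷ p} here        (there _)   ()
rank-injective {p = inside  ∷ p} (there _)   here        ()
rank-injective {p = inside  ∷ p} (there x∈p) (there y∈p) eq =
  cong suc (rank-injective x∈p y∈p (suc-injective eq))
rank-injective {p = outside ∷ p} (there x∈p) (there y∈p) eq =
  cong suc (rank-injective x∈p y∈p eq)

module _ {m} {P : Pred (Fin m) 0ℓ} (P? : Decidable P) where

  subset : Subset m
  subset = tabulate (does ∘ P?)

  ∈-subset⁺ : ∀ {x} → P x → x ∈ subset
  ∈-subset⁺ {x} px =
    lookup⇒[]= x subset (trans (lookup∘tabulate (does ∘ P?) x) (dec-true (P? x) px))

  ∈-subset⁻ : ∀ {x} → x ∈ subset → P x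
  ∈-subset⁻ {x} x∈ =
    toWitness {a? = P? x} (Equivalence.from T-≡ (begin
      isYes (P? x)       ≡⟨ isYes≗does (P? x) ⟩
      does (P? x)        ≡⟨ lookup∘tabulate (does ∘ P?) x ⟨
      Vec.lookup subset x ≡⟨ []=⇒lookup x∈ ⟩
      true               ∎))

  -- The default is returned only when no element satisfies P.
  witness : Fin m → Fin m
  witness default with any? P?
  ... | yes (x , _) = x
  ... | no _        = default

  witness-satisfies : ∀ default {x} → P x → P (witness default)
  witness-satisfies default {x} px with any? P?
  ... | yes (_ , py) = py
  ... | no ¬∃P       = ⊥-elim (¬∃P (x , px))

module _ {n} (G : FinGroup n) where
  open FinGroup G

  asGroup : Group 0ℓ 0ℓ
  asGroup = record
    { Carrier = Fin n ; _≈_ = _≡_ ; _∙_ = _·_ ; ε = e ; _⁻¹ = inv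
    ; isGroup = record
      { isMonoid = record
        { isSemigroup = record
          { isMagma = record { isEquivalence = isEquivalence ; ∙-cong = cong₂ _·_ }
          ; assoc = assoc }
        ; identity = identˡ , identʳ }
      ; inverse = inverseˡ , inverseʳ
      ; ⁻¹-cong = cong inv } }

  open GroupProperties asGroup
    using (⁻¹-anti-homo-∙; ∙-cancelˡ; ∙-cancelʳ; //-rightDividesˡ; //-rightDividesʳ)

  ρ : Fin n → Fin n → Fin n
  ρ g u = u · g

  ρ-quotient : ∀ g u v → (v · g) · inv (u · g) ≡ v · inv u
  ρ-quotient g u v = begin
    (v · g) · inv (u · g)     ≡⟨ cong ((v · g) ·_) (⁻¹-anti-homo-∙ u g) ⟩
    (v · g) · (inv g · inv u) ≡⟨ sym (assoc (v · g) (inv g) (inv u)) ⟩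
    ((v · g) · inv g) · inv u ≡⟨ cong (_· inv u) (//-rightDividesʳ g v) ⟩
    v · inv u                 ∎

  ρ-isAut : ∀ S g → IsAut G S (ρ g)
  ρ-isAut S g =
    ( (λ {x} {y} → ∙-cancelʳ g x y)
    , λ y → y · inv g , λ z≡ → trans (cong (_· g) z≡) (//-rightDividesˡ g y) )
    , λ u v → subst (_∈ S) (sym (ρ-quotient g u v)) , subst (_∈ S) (ρ-quotient g u v)

  ∘-isAut : ∀ {S f g} → IsAut G S f → IsAut G S g → IsAut G S (f ∘ g)
  ∘-isAut {f = f} {g} (f-bij , f-arc) (g-bij , g-arc) =
    bijective _≡_ _≡_ _≡_ g-bij f-bij ,
    λ u v → proj₁ (f-arc (g u) (g v)) ∘ proj₁ (g-arc u v)
          , proj₂ (g-arc u v) ∘ proj₂ (f-arc (g u) (g v))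

  module Regular {S} {H : Pred (Fin n → Fin n) 0ℓ} (R : IsRegularSubgroupOfAut G S H) where
    open IsRegularSubgroupOfAut R

    h⟨_⟩ : Fin n → Fin n → Fin n
    h⟨ a ⟩ = proj₁ (transitive e a)

    h⟨⟩∈H : ∀ a → H h⟨ a ⟩
    h⟨⟩∈H a = proj₁ (proj₂ (transitive e a))

    h⟨⟩-e : ∀ a → h⟨ a ⟩ e ≡ a
    h⟨⟩-e a = proj₂ (proj₂ (transitive e a))

    ∈H⇒≗h⟨⟩ : ∀ {f} → H f → f ≗ h⟨ f e ⟩
    ∈H⇒≗h⟨⟩ Hf = semiregular e Hf (h⟨⟩∈H _) (sym (h⟨⟩-e _))

    H? : Decidable H
    H? f = map′ (λ f≗ → resp (h⟨⟩∈H (f e)) (sym ∘ f≗)) ∈H⇒≗h⟨⟩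
                (all? (λ u → f u ≟ h⟨ f e ⟩ u))

    ∈H-cancelˡ : ∀ {f g} → H f → H (f ∘ g) → H g
    ∈H-cancelˡ {g = g} Hf Hfg =
      let f⁻¹ , Hf⁻¹ , f⁻¹∘f≗id , _ = inv-closed Hf
      in resp (∘-closed Hf⁻¹ Hfg) (f⁻¹∘f≗id ∘ g)

    ρe∈H : H (ρ e)
    ρe∈H = resp has-id (sym ∘ identʳ)

    K : Subset n
    K = subset (H? ∘ ρ)

    K-isSubgroup : IsSubgroup G K
    K-isSubgroup =
        ∈-subset⁺ (H? ∘ ρ) ρe∈H
      , (λ {x} {y} x∈K y∈K → ∈-subset⁺ (H? ∘ ρ)
          (resp (∘-closed (∈-subset⁻ (H? ∘ ρ) y∈K) (∈-subset⁻ (H? ∘ ρ) x∈K)) (λ u → assoc u x y)))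
      , λ {x} x∈K → ∈-subset⁺ (H? ∘ ρ)
          (∈H-cancelˡ (∈-subset⁻ (H? ∘ ρ) x∈K) (resp has-id (λ u → sym (//-rightDividesˡ x u))))

    module _ (L : List (Fin n → Fin n)) (complete : ∀ f → IsAut G S f → Any (f ≗_) L) where

      idx : Fin n → Fin n → Fin (length L)
      idx a b = index (complete (h⟨ a ⟩ ∘ ρ b) (∘-isAut (⊆Aut (h⟨⟩∈H a)) (ρ-isAut S b)))

      idx-spec : ∀ a b → h⟨ a ⟩ ∘ ρ b ≗ lookup L (idx a b)
      idx-spec a b = lookup-index (complete (h⟨ a ⟩ ∘ ρ b) (∘-isAut (⊆Aut (h⟨⟩∈H a)) (ρ-isAut S b)))

      idx-recovers : ∀ a b → lookup L (idx a b) (inv b) ≡ a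
      idx-recovers a b = begin
        lookup L (idx a b) (inv b) ≡⟨ sym (idx-spec a b (inv b)) ⟩
        h⟨ a ⟩ (inv b · b)          ≡⟨ cong h⟨ a ⟩ (inverseˡ b) ⟩
        h⟨ a ⟩ e                    ≡⟨ h⟨⟩-e a ⟩
        a                           ∎

      idx-shift : ∀ a b c → lookup L (idx a b) ∘ ρ (inv c) ≗ h⟨ a ⟩ ∘ ρ (inv c · b)
      idx-shift a b c u = begin
        lookup L (idx a b) (u · inv c) ≡⟨ sym (idx-spec a b (u · inv c)) ⟩
        h⟨ a ⟩ ((u · inv c) · b)        ≡⟨ cong h⟨ a ⟩ (assoc u (inv c) b) ⟩
        h⟨ a ⟩ (u · (inv c · b))        ∎

      -- The pairs (a , b) with h⟨ a ⟩ ∘ ρ b equal to the j-th automorphism have all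
      -- their b in one coset of K and a determined by b, so b is recorded by its
      -- offset from the chosen point rep j of that coset.
      InCoset : Fin (length L) → Pred (Fin n) 0ℓ
      InCoset j c = H (lookup L j ∘ ρ (inv c))

      rep : Fin (length L) → Fin n
      rep j = witness (λ c → H? (lookup L j ∘ ρ (inv c))) e

      in-own-coset : ∀ a b → InCoset (idx a b) b
      in-own-coset a b =
        resp (∘-closed (h⟨⟩∈H a) (subst (H ∘ ρ) (sym (inverseˡ b)) ρe∈H)) (sym ∘ idx-shift a b b)

      offset∈K : ∀ a b → inv (rep (idx a b)) · b ∈ K
      offset∈K a b = ∈-subset⁺ (H? ∘ ρ) (∈H-cancelˡ (h⟨⟩∈H a)
        (resp (witness-satisfies (λ c → H? (lookup L j ∘ ρ (inv c))) e (in-own-coset a b))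
              (idx-shift a b (rep j))))
        where j = idx a b

      encode : Fin n × Fin n → Fin (length L) × Fin ∣ K ∣
      encode (a , b) = idx a b , rank (offset∈K a b)

      encode-injective : Injective _≡_ _≡_ encode
      encode-injective {a , b} {a′ , b′} eq = cong₂ _,_ a≡a′ b≡b′
        where
        j≡j′ : idx a b ≡ idx a′ b′
        j≡j′ = cong proj₁ eq

        b≡b′ : b ≡ b′
        b≡b′ = ∙-cancelˡ (inv (rep (idx a b))) b b′
          (trans (rank-injective (offset∈K a b) (offset∈K a′ b′) (cong proj₂ eq))
                 (cong (λ j → inv (rep j) · b′) (sym j≡j′)))

        a≡a′ : a ≡ a′
        a≡a′ = begin
          a                            ≡⟨ sym (idx-recovers a b) ⟩
          lookup L (idx a b) (inv b)   ≡⟨ cong₂ (λ j c → lookup L j (inv c)) j≡j′ b≡b′ ⟩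
          lookup L (idx a′ b′) (inv b′) ≡⟨ idx-recovers a′ b′ ⟩
          a′                           ∎

      n*n≤∣L∣*∣K∣ : n * n ≤ length L * ∣ K ∣
      n*n≤∣L∣*∣K∣ = ×-injective⇒*-≤ encode-injective

    K-properOfIndexAtMost : ∀ {i} → HasCayleyIndex G S i → ∃ (λ g → ¬ H (ρ g)) →
                            HasProperSubgroupOfIndexAtMost G i
    K-properOfIndexAtMost {i} (L , _ , complete , _ , ∣L∣≡i*n) (g , ρg∉H) =
      K , K-isSubgroup , (g , ρg∉H ∘ ∈-subset⁻ (H? ∘ ρ)) ,
      *-cancelˡ-≤ n (subst (n * n ≤_) ∣L∣*∣K∣≡n*[i*∣K∣] (n*n≤∣L∣*∣K∣ L complete))
      where
      instance
        n≢0 : NonZero n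
        n≢0 = nonZeroIndex e

      ∣L∣*∣K∣≡n*[i*∣K∣] : length L * ∣ K ∣ ≡ n * (i * ∣ K ∣)
      ∣L∣*∣K∣≡n*[i*∣K∣] = begin
        length L * ∣ K ∣ ≡⟨ cong (_* ∣ K ∣) (trans ∣L∣≡i*n (*-comm i n)) ⟩
        n * i * ∣ K ∣    ≡⟨ *-assoc n i ∣ K ∣ ⟩
        n * (i * ∣ K ∣)  ∎

  ⊇ρ⇒≗ρ : ∀ {S H} → IsRegularSubgroupOfAut G S H → (∀ g → H (ρ g)) →
          ∀ {f} → H f → f ≗ ρ (f e)
  ⊇ρ⇒≗ρ R ρ∈H {f} Hf =
    IsRegularSubgroupOfAut.semiregular R e Hf (ρ∈H (f e)) (sym (identˡ (f e)))

  regularSubgroupOmittingρ : ∀ {S} → TwoRegularSubgroups G S →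
    Σ (Pred (Fin n → Fin n) 0ℓ) λ H → IsRegularSubgroupOfAut G S H × ∃ λ g → ¬ H (ρ g)
  regularSubgroupOmittingρ (H₁ , H₂ , R₁ , R₂ , f , H₁f , ¬H₂f)
    with all? (Regular.H? R₁ ∘ ρ) | all? (Regular.H? R₂ ∘ ρ)
  ... | no ¬ρ⊆H₁ | _ = H₁ , R₁ , ¬∀⟶∃¬ n _ (Regular.H? R₁ ∘ ρ) ¬ρ⊆H₁
  ... | yes _ | no ¬ρ⊆H₂ = H₂ , R₂ , ¬∀⟶∃¬ n _ (Regular.H? R₂ ∘ ρ) ¬ρ⊆H₂
  ... | yes ρ⊆H₁ | yes ρ⊆H₂ =
    ⊥-elim (¬H₂f (IsRegularSubgroupOfAut.resp R₂ (ρ⊆H₂ (f e)) (sym ∘ ⊇ρ⇒≗ρ R₁ ρ⊆H₁ H₁f)))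

lemma3p2 : ∀ {n : ℕ} (G : FinGroup n) (S : Subset n) (i : ℕ)
             → FinGroup.e G ∉ S
             → HasCayleyIndex G S i
             → TwoRegularSubgroups G S
             → HasProperSubgroupOfIndexAtMost G i
lemma3p2 G S i _ cayleyIndex twoRegular =
  let H , R , omitted = regularSubgroupOmittingρ G twoRegular
  in Regular.K-properOfIndexAtMost G R {i} cayleyIndex omitted
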